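{- Let $G$ be a graph of order $m\geq 2$ and let $H$ be a rooted graph of order $n\geq 2$. Then $$\operatorname{dem}(G)\leq \operatorname{dem}(G\odot H)\leq m\operatorname{dem}(H).$$ Moreover, $\operatorname{dem}(G\odot H)=\operatorname{dem}(G)$ if and only if $H$ is a tree.
   Context: Throughout, all graphs are finite, simple, undirected and connected. For a graph $G$, a set $M\subseteq V(G)$ and an edge $e\in E(G)$, $P_G(M,e)$ is the set of pairs $(x,y)$ with $x\in M$, $y\in V(G)$ such that $d_G(x,y)\neq d_{G-e}(x,y)$. An edge $e$ is monitored by a vertex $x$ if $P_G(\{x\},e)\neq\emptyset$. A set $M\subseteq V(G)$ is a distance-edge-monitoring set if every edge of $G$ is monitored by some vertex of $M$; $\operatorname{dem}(G)$ is the minimum size of a distance-edge-monitoring set. The cluster (rooted product) $G\odot H$, where $V(G)=\{u_1,\dots,u_m\}$ and $H$ is a rooted graph, is obtained by taking one copy of $G$ and $m$ disjoint copies of $H$ and identifying the root of the $i$-th copy of $H$ with $u_i$, for $i=1,\dots,m$. -}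

module Defs where

open import Data.Nat using (ℕ; zero; suc; _+_; _*_; _≤_; _<_)
open import Data.Bool using (Bool; true; false; _∧_; _∨_; not)
open import Data.Bool.Properties using (∧-comm; ∨-comm)
open import Data.Fin using (Fin; remQuot)
open import Data.Fin.Properties using (_≟_)
open import Data.Fin.Subset using (Subset; _∈_; ∣_∣)
open import Data.Vec using (Vec; lookup)
open import Data.Product using (Σ; ∃; _×_; _,_; proj₁; proj₂)
open import Relation.Nullary using (¬_; yes; no)
open import Relation.Nullary.Decidable using (⌊_⌋)
open import Relation.Binary.PropositionalEquality using (_≡_; refl; sym; cong; cong₂)
open import Function using (Injective)

Adjacency : ℕ → Set
Adjacency n = Fin n → Fin n → Bool

record Graph (n : ℕ) : Set where
  field
    adj     : Adjacency n
    adj-sym : ∀ x y → adj x y ≡ adj y x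
    irrefl  : ∀ x → adj x x ≡ false
open Graph public

Edge : ∀ {n} → Adjacency n → Fin n → Fin n → Set
Edge A x y = A x y ≡ true

data Walk {n : ℕ} (A : Adjacency n) : Fin n → Fin n → ℕ → Set where
  here : ∀ {x} → Walk A x x zero
  step : ∀ {x y z k} → Edge A x y → Walk A y z k → Walk A x z (suc k)

IsDist : ∀ {n} → Adjacency n → Fin n → Fin n → ℕ → Set
IsDist A x y k = Walk A x y k × (∀ j → j < k → ¬ Walk A x y j)

Connected : ∀ {n} → Graph n → Set
Connected {n} G = ∀ (x y : Fin n) → ∃ λ k → Walk (adj G) x y k

_==_ : ∀ {n} → Fin n → Fin n → Bool
x == y = ⌊ x ≟ y ⌋

deleteEdge : ∀ {n} → Graph n → Fin n → Fin n → Adjacency n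
deleteEdge G u v x y =
  adj G x y ∧ not (((x == u) ∧ (y == v)) ∨ ((x == v) ∧ (y == u)))

-- d_G(x,y) ≠ d_{G-uv}(x,y)  (a distance that becomes infinite counts as different).
DistChanges : ∀ {n} → Graph n → Fin n → Fin n → Fin n → Fin n → Set
DistChanges G u v x y =
  ¬ (∃ λ k → IsDist (adj G) x y k × IsDist (deleteEdge G u v) x y k)

Monitors : ∀ {n} → Graph n → Fin n → Fin n → Fin n → Set
Monitors {n} G x u v = ∃ λ (y : Fin n) → DistChanges G u v x y

IsDEM : ∀ {n} → Graph n → Subset n → Set
IsDEM {n} G M = ∀ (u v : Fin n) → Edge (adj G) u v →
  ∃ λ (x : Fin n) → x ∈ M × Monitors G x u v

IsDem : ∀ {n} → Graph n → ℕ → Set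
IsDem {n} G k =
  (∃ λ (M : Subset n) → IsDEM G M × ∣ M ∣ ≡ k) ×
  (∀ (M : Subset n) → IsDEM G M → k ≤ ∣ M ∣)

record Cycle {n : ℕ} (G : Graph n) : Set where
  field
    len      : ℕ
    len≥3    : 3 ≤ len
    vs       : Vec (Fin n) len
    distinct : Injective _≡_ _≡_ (lookup vs)
    path     : ∀ (i : Fin len) (j : Fin len) → Data.Fin.toℕ j ≡ suc (Data.Fin.toℕ i) →
               Edge (adj G) (lookup vs i) (lookup vs j)
    closing  : ∀ (i : Fin len) (j : Fin len) → suc (Data.Fin.toℕ i) ≡ len → Data.Fin.toℕ j ≡ 0 →
               Edge (adj G) (lookup vs i) (lookup vs j)

IsTree : ∀ {n} → Graph n → Set
IsTree G = Connected G × ¬ Cycle G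

-- Rooted product G ⊙ H.  The vertex (i , j) ∈ Fin m × Fin n (encoded in
-- Fin (m * n) via remQuot/combine) is vertex j of the i-th copy of H;
-- (i , r) is identified with u_i of G.

==-sym : ∀ {n} (x y : Fin n) → (x == y) ≡ (y == x)
==-sym x y with x ≟ y | y ≟ x
... | yes _ | yes _ = refl
... | no _  | no _  = refl
... | yes p | no q  = Data.Empty.⊥-elim (q (sym p))
  where import Data.Empty
... | no p  | yes q = Data.Empty.⊥-elim (p (sym q))
  where import Data.Empty

==-refl : ∀ {n} (x : Fin n) → (x == x) ≡ true
==-refl x with x ≟ x
... | yes _ = refl
... | no p  = Data.Empty.⊥-elim (p refl)
  where import Data.Empty

prodAdjPair : ∀ {m n} → Graph m → Graph n → Fin n →
              Fin m × Fin n → Fin m × Fin n → Bool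
prodAdjPair G H r (i , j) (i' , j') =
  ((i == i') ∧ adj H j j') ∨ (((j == r) ∧ (j' == r)) ∧ adj G i i')

prodAdjPair-sym : ∀ {m n} (G : Graph m) (H : Graph n) (r : Fin n) p q →
  prodAdjPair G H r p q ≡ prodAdjPair G H r q p
prodAdjPair-sym G H r (i , j) (i' , j') =
  cong₂ _∨_ (cong₂ _∧_ (==-sym i i') (adj-sym H j j'))
            (cong₂ _∧_ (∧-comm (j == r) (j' == r)) (adj-sym G i i'))

prodAdjPair-irr : ∀ {m n} (G : Graph m) (H : Graph n) (r : Fin n) p →
  prodAdjPair G H r p p ≡ false
prodAdjPair-irr G H r (i , j)
  rewrite ==-refl i | irrefl H j | irrefl G i | Data.Bool.Properties.∧-zeroʳ ((j == r) ∧ (j == r)) = refl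

_⊙_at_ : ∀ {m n} → Graph m → Graph n → Fin n → Graph (m * n)
_⊙_at_ {m} {n} G H r = record
  { adj     = λ x y → prodAdjPair G H r (remQuot n x) (remQuot n y)
  ; adj-sym = λ x y → prodAdjPair-sym G H r (remQuot n x) (remQuot n y)
  ; irrefl  = λ x → prodAdjPair-irr G H r (remQuot n x)
  }

{-# OPTIONS --safe #-}
-- Walks in G ⊙ H project, without getting longer, onto G (forget the position inside the
-- copy) and onto any copy of H (send the other copies to its root). Hence distances inside
-- a copy are those of H, distances between roots are those of G, and monitoring transfers
-- along these retractions. A DEM of H placed in every copy is therefore a DEM of G ⊙ H (a
-- root edge is monitored from the adjacent copy), and the copies met by a DEM of G ⊙ H form
-- a DEM of G. If H is a tree every copy edge is a bridge, so a DEM of G placed at the roots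
-- already suffices. If H has a cycle, one of the two cycle edges at a cycle vertex farthest
-- from the root has both ends reachable from the root by shortest walks avoiding it; its
-- copies can only be monitored from inside their own copy, so dem(G ⊙ H) ≥ m > dem(G).

module Submission where

open import Defs
open import Data.Nat using (ℕ; zero; suc; _+_; _*_; _∸_; _≤_; _<_; z≤n; s≤s; _<?_; _≤?_)
open import Data.Nat.Properties hiding (_≟_)
open import Data.Nat.Induction using (<-rec)
open import Data.Bool using (Bool; true; false; _∧_; _∨_; not; if_then_else_)
import Data.Bool.Properties as Bool
open import Data.Fin using (Fin; zero; suc; toℕ; fromℕ<; combine; remQuot; _↑ˡ_; _↑ʳ_)
open import Data.Fin.Properties using (_≟_; any?; toℕ<n; toℕ-injective; toℕ-fromℕ<; remQuot-combine; combine-remQuot)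
open import Data.Fin.Subset using (Subset; outside; ⊤; ⊥; ⁅_⁆; ∣_∣; _∈_; Nonempty)
open import Data.Fin.Subset.Properties using (∈⊤; ∣⊤∣≡n; nonempty?; x∈⁅x⁆; ∣⁅x⁆∣≡1; ∣⊥∣≡0; x∈p⇒∣p-x∣<∣p∣)
open import Data.Vec using ([]; _∷_; there; lookup; tabulate)
open import Data.Vec.Properties using (lookup∘tabulate; tabulate∘lookup; tabulate-cong; []=⇒lookup; lookup⇒[]=)
open import Data.Product using (∃; ∃₂; _×_; _,_; proj₁; proj₂)
open import Data.Sum using (_⊎_; inj₁; inj₂)
open import Data.Empty using (⊥-elim)
open import Function using (id; _∘_; Injective)
open import Function.Bundles using (_⇔_; mk⇔)
open import Relation.Nullary using (¬_; Dec; yes; no; does)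
open import Relation.Nullary.Decidable using (_×-dec_; _⊎-dec_; map′; ¬?; dec-true; dec-false; isYes≗does; decidable-stable)
open import Relation.Binary.PropositionalEquality
open import Relation.Binary.Definitions using (tri<; tri≈; tri>)

private variable
  n n′ n″ a b c d k l : ℕ

-- Walks

edge-sym : (G : Graph n) {x y : Fin n} → Edge (adj G) x y → Edge (adj G) y x
edge-sym G {x} {y} e = trans (adj-sym G y x) e

edge⇒≢ : (G : Graph n) {x y : Fin n} → Edge (adj G) x y → x ≢ y
edge⇒≢ G {x} e refl with () ← trans (sym (irrefl G x)) e

module _ {A : Adjacency n} where

  infixr 5 _++ʷ_
  infixl 5 _∷ʳʷ_

  _++ʷ_ : ∀ {x y z} → Walk A x y a → Walk A y z b → Walk A x z (a + b)
  here     ++ʷ q = q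
  step e p ++ʷ q = step e (p ++ʷ q)

  _∷ʳʷ_ : ∀ {x y z} → Walk A x y a → Edge A y z → Walk A x z (suc a)
  here       ∷ʳʷ e = step e here
  step e′ p  ∷ʳʷ e = step e′ (p ∷ʳʷ e)

  castʷ : ∀ {x x′ y y′} → x ≡ x′ → y ≡ y′ → Walk A x y k → Walk A x′ y′ k
  castʷ refl refl p = p

mapʷ : {A : Adjacency n} {B : Adjacency n′} (f : Fin n → Fin n′) →
       (∀ {x y} → Edge A x y → Edge B (f x) (f y)) →
       ∀ {x y} → Walk A x y k → Walk B (f x) (f y) k
mapʷ f h here       = here
mapʷ f h (step e p) = step (h e) (mapʷ f h p)

reverseʷ : (G : Graph n) {x y : Fin n} → Walk (adj G) x y k → Walk (adj G) y x k
reverseʷ G here       = here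
reverseʷ G (step e p) = reverseʷ G p ∷ʳʷ edge-sym G e

SplitStep : (B : Adjacency n′) (C : Adjacency n″) → (Fin n → Fin n′) → (Fin n → Fin n″) →
            Fin n → Fin n → Set
SplitStep B C f g x y =
  (Edge B (f x) (f y) × g x ≡ g y) ⊎ (f x ≡ f y × Edge C (g x) (g y)) ⊎ (f x ≡ f y × g x ≡ g y)

splitʷ : {A : Adjacency n} {B : Adjacency n′} {C : Adjacency n″}
         (f : Fin n → Fin n′) (g : Fin n → Fin n″) → (∀ {x y} → Edge A x y → SplitStep B C f g x y) →
         ∀ {x y} → Walk A x y k →
         ∃₂ λ a b → a + b ≤ k × Walk B (f x) (f y) a × Walk C (g x) (g y) b
splitʷ f g h here = 0 , 0 , z≤n , here , here
splitʷ f g h (step e p) with splitʷ f g h p | h e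
... | a , b , a+b≤k , p₁ , p₂ | inj₁ (e₁ , eq₂) =
  suc a , b , s≤s a+b≤k , step e₁ p₁ , castʷ (sym eq₂) refl p₂
... | a , b , a+b≤k , p₁ , p₂ | inj₂ (inj₁ (eq₁ , e₂)) =
  a , suc b , ≤-trans (≤-reflexive (+-suc a b)) (s≤s a+b≤k) , castʷ (sym eq₁) refl p₁ , step e₂ p₂
... | a , b , a+b≤k , p₁ , p₂ | inj₂ (inj₂ (eq₁ , eq₂)) =
  a , b , m≤n⇒m≤1+n a+b≤k , castʷ (sym eq₁) refl p₁ , castʷ (sym eq₂) refl p₂

-- Distances

Least : (ℕ → Set) → ℕ → Set
Least P d = P d × (∀ j → j < d → ¬ P j)

least : {P : ℕ → Set} → (∀ j → Dec (P j)) → ∀ k → P k → ∃ (Least P)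
least {P} P? = <-rec (λ k → P k → ∃ (Least P)) below
  where
  below : ∀ k → (∀ {j} → j < k → P j → ∃ (Least P)) → P k → ∃ (Least P)
  below k rec Pk with anyUpTo? P? k
  ... | yes (j , j<k , Pj) = rec j<k Pj
  ... | no ∄               = k , Pk , λ j j<k Pj → ∄ (j , j<k , Pj)

walk? : (A : Adjacency n) → ∀ k x y → Dec (Walk A x y k)
walk? A zero x y with x ≟ y
... | yes refl = yes here
... | no x≢y   = no λ { here → x≢y refl }
walk? A (suc k) x y with any? (λ z → (A x z Bool.≟ true) ×-dec walk? A k z y)
... | yes (z , e , p) = yes (step e p)
... | no ∄            = no λ { (step e p) → ∄ (_ , e , p) }

dist-exists : {A : Adjacency n} {x y : Fin n} → Walk A x y k → ∃ (IsDist A x y)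
dist-exists {k = k} {A = A} {x} {y} p = least (λ j → walk? A j x y) k p

dist : (G : Graph n) → Connected G → ∀ x y → ∃ (IsDist (adj G) x y)
dist G conn x y = dist-exists (proj₂ (conn x y))

dist-unique : {A : Adjacency n} {x y : Fin n} {d d′ : ℕ} → IsDist A x y d → IsDist A x y d′ → d ≡ d′
dist-unique {d = d} {d′} (p , min) (p′ , min′) with <-cmp d d′
... | tri< d<d′ _ _ = ⊥-elim (min′ d d<d′ p)
... | tri≈ _ d≡d′ _ = d≡d′
... | tri> _ _ d>d′ = ⊥-elim (min d′ d>d′ p′)

dist≤length : {A : Adjacency n} {x y : Fin n} → IsDist A x y d → Walk A x y k → d ≤ k
dist≤length {d = d} {k} (_ , min) p with ≤-<-connex d k
... | inj₁ d≤k = d≤k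
... | inj₂ k<d = ⊥-elim (min k k<d p)

isDist? : (A : Adjacency n) → ∀ x y d → Dec (IsDist A x y d)
isDist? A x y d = walk? A d x y ×-dec
  map′ (λ all j j<d → all j<d) (λ all {j} j<d → all j j<d) (allUpTo? (λ j → ¬? (walk? A j x y)) d)

dist-transfer : {A : Adjacency n} {B : Adjacency n′} {x y : Fin n} {x′ y′ : Fin n′} →
                (∀ {j} → Walk B x′ y′ j → Walk A x y j) →
                IsDist A x y d → Walk B x′ y′ k → k ≤ d → IsDist B x′ y′ d
dist-transfer embed (_ , min) p k≤d with m≤n⇒m<n∨m≡n k≤d
... | inj₁ k<d  = ⊥-elim (min _ k<d (embed p))
... | inj₂ refl = p , λ j j<d q → min j j<d (embed q)

-- Removing an edge

SameEdge : {V : Set} → V → V → V → V → Set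
SameEdge u v x y = (x ≡ u × y ≡ v) ⊎ (x ≡ v × y ≡ u)

sameEdge? : (u v x y : Fin n) → Dec (SameEdge u v x y)
sameEdge? u v x y = (x ≟ u ×-dec y ≟ v) ⊎-dec (x ≟ v ×-dec y ≟ u)

module _ {V : Set} {u v x y : V} where

  SameEdge-swap : SameEdge u v x y → SameEdge v u x y
  SameEdge-swap (inj₁ s) = inj₂ s
  SameEdge-swap (inj₂ s) = inj₁ s

  SameEdge-map : {W : Set} (f : V → W) → SameEdge u v x y → SameEdge (f u) (f v) (f x) (f y)
  SameEdge-map f (inj₁ (refl , refl)) = inj₁ (refl , refl)
  SameEdge-map f (inj₂ (refl , refl)) = inj₂ (refl , refl)

  SameEdge-reflect : {W : Set} {f : V → W} → Injective _≡_ _≡_ f →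
                     SameEdge (f u) (f v) (f x) (f y) → SameEdge u v x y
  SameEdge-reflect f-inj (inj₁ (fx≡ , fy≡)) = inj₁ (f-inj fx≡ , f-inj fy≡)
  SameEdge-reflect f-inj (inj₂ (fx≡ , fy≡)) = inj₂ (f-inj fx≡ , f-inj fy≡)

  SameEdge-within : ∀ {w} → u ≡ w → v ≡ w → SameEdge u v x y → x ≡ w × y ≡ w
  SameEdge-within refl refl (inj₁ (refl , refl)) = refl , refl
  SameEdge-within refl refl (inj₂ (refl , refl)) = refl , refl

SameEdge-loop : {V : Set} {u v x : V} → SameEdge u v x x → u ≡ v
SameEdge-loop (inj₁ (refl , refl)) = refl
SameEdge-loop (inj₂ (refl , refl)) = refl

SameEdge-subst : {V : Set} {u v x y x′ y′ : V} → x ≡ x′ → y ≡ y′ → SameEdge u v x y → SameEdge u v x′ y′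
SameEdge-subst refl refl s = s

removeEdge : Graph n → Fin n → Fin n → Graph n
removeEdge G u v = record
  { adj     = deleteEdge G u v
  ; adj-sym = λ x y → cong₂ _∧_ (adj-sym G x y) (cong not (flag-sym x y))
  ; irrefl  = λ x → cong (_∧ _) (irrefl G x)
  }
  where
  flag-sym : ∀ x y → ((x == u) ∧ (y == v)) ∨ ((x == v) ∧ (y == u)) ≡
                     ((y == u) ∧ (x == v)) ∨ ((y == v) ∧ (x == u))
  flag-sym x y = trans (cong₂ _∨_ (Bool.∧-comm (x == u) (y == v)) (Bool.∧-comm (x == v) (y == u)))
                       (Bool.∨-comm ((y == v) ∧ (x == u)) ((y == u) ∧ (x == v)))

removal-flag : (u v x y : Fin n) → ((x == u) ∧ (y == v)) ∨ ((x == v) ∧ (y == u)) ≡ does (sameEdge? u v x y)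
removal-flag u v x y = cong₂ _∨_ (cong₂ _∧_ (isYes≗does (x ≟ u)) (isYes≗does (y ≟ v)))
                                 (cong₂ _∧_ (isYes≗does (x ≟ v)) (isYes≗does (y ≟ u)))

∧-true : ∀ {p q} → p ∧ q ≡ true → p ≡ true × q ≡ true
∧-true {true} {true} _ = refl , refl

∨-true : ∀ {p q} → p ∨ q ≡ true → p ≡ true ⊎ q ≡ true
∨-true {true}  _ = inj₁ refl
∨-true {false} e = inj₂ e

==⇒≡ : {x y : Fin n} → (x == y) ≡ true → x ≡ y
==⇒≡ {x = x} {y} eq with x ≟ y
... | yes x≡y = x≡y

module _ (G : Graph n) {u v : Fin n} where
  private
    G⁻ : Graph n
    G⁻ = removeEdge G u v

  removed⇒edge : ∀ {x y} → Edge (adj G⁻) x y → Edge (adj G) x y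
  removed⇒edge e = proj₁ (∧-true e)

  removed⇒¬same : ∀ {x y} → Edge (adj G⁻) x y → ¬ SameEdge u v x y
  removed⇒¬same {x} {y} e s
    with () ← trans (sym (cong not (trans (removal-flag u v x y) (dec-true (sameEdge? u v x y) s))))
                    (proj₂ (∧-true e))

  edge⇒removed : ∀ {x y} → Edge (adj G) x y → ¬ SameEdge u v x y → Edge (adj G⁻) x y
  edge⇒removed {x} {y} e ¬s =
    cong₂ _∧_ e (cong not (trans (removal-flag u v x y) (dec-false (sameEdge? u v x y) ¬s)))

  detour≥2 : Edge (adj G) u v → Walk (adj G⁻) u v k → 2 ≤ k
  detour≥2 e here                  = ⊥-elim (edge⇒≢ G e refl)
  detour≥2 e (step e′ here)        = ⊥-elim (removed⇒¬same e′ (inj₁ (refl , refl)))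
  detour≥2 e (step _ (step _ _))   = s≤s (s≤s z≤n)

  avoids-or-visits : ∀ {x y} → Walk (adj G) x y k →
    Walk (adj G⁻) x y k ⊎ ∃₂ λ t s → t + s ≡ k × Walk (adj G) x v t × Walk (adj G) v y s
  avoids-or-visits here = inj₁ here
  avoids-or-visits {x = x} (step {y = z} e p) with sameEdge? u v x z
  ... | yes (inj₁ (refl , refl)) = inj₂ (1 , _ , refl , step e here , p)
  ... | yes (inj₂ (refl , refl)) = inj₂ (0 , _ , refl , here , step e p)
  ... | no ¬s with avoids-or-visits p
  ...   | inj₁ q                       = inj₁ (step (edge⇒removed e ¬s) q)
  ...   | inj₂ (t , s , eq , p₁ , p₂)  = inj₂ (suc t , s , cong suc eq , step e p₁ , p₂)

  shortest-avoids : ∀ {x y d′} → y ≢ v → IsDist (adj G) x y d → IsDist (adj G) x v d′ → d ≤ d′ →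
                    Walk (adj G⁻) x y d
  shortest-avoids y≢v (p , _) (_ , minᵥ) d≤d′ with avoids-or-visits p
  ... | inj₁ q                                 = q
  ... | inj₂ (t , zero , _ , _ , here)         = ⊥-elim (y≢v refl)
  ... | inj₂ (t , suc s , refl , p₁ , _)       = ⊥-elim (minᵥ t (≤-trans (m<m+n t (s≤s z≤n)) d≤d′) p₁)

  -- d_{G - uv}(x, w) = d_G(x, w), phrased without distances
  Avoidable : Fin n → Fin n → Set
  Avoidable x w = ∀ {t} → Walk (adj G) x w t → ∃ λ t′ → t′ ≤ t × Walk (adj G⁻) x w t′

  avoidable-by : ∀ {x w t} → IsDist (adj G) x w d → Walk (adj G⁻) x w t → t ≤ d → Avoidable x w
  avoidable-by {t = t} isd q t≤d p = t , ≤-trans t≤d (dist≤length isd p) , q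

  changes⊎avoidable : Connected G → ∀ x w → DistChanges G u v x w ⊎ Avoidable x w
  changes⊎avoidable conn x w with dist G conn x w
  ... | d , isd with isDist? (adj G⁻) x w d
  ...   | yes isd⁻ = inj₂ (avoidable-by isd (proj₁ isd⁻) ≤-refl)
  ...   | no ¬isd⁻ = inj₁ λ { (d′ , isd′ , isd′⁻) →
                        ¬isd⁻ (subst (IsDist (adj G⁻) x w) (dist-unique isd′ isd) isd′⁻) }

  -- Each time the walk crosses uv it has just reached u or v, and is rerouted there.
  avoidable-walk : ∀ {x y} → Avoidable x u → Avoidable x v → Walk (adj G) x y k →
                   ∃ λ k′ → k′ ≤ k × Walk (adj G⁻) x y k′
  avoidable-walk {x = x} avᵤ avᵥ = extend 0 (0 , z≤n , here)
    where
    via : ∀ {w t} → w ≡ u ⊎ w ≡ v → Walk (adj G) x w t → ∃ λ t′ → t′ ≤ t × Walk (adj G⁻) x w t′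
    via (inj₁ refl) = avᵤ
    via (inj₂ refl) = avᵥ

    endpoint : ∀ {z w} → SameEdge u v z w → w ≡ u ⊎ w ≡ v
    endpoint (inj₁ (_ , w≡v)) = inj₂ w≡v
    endpoint (inj₂ (_ , w≡u)) = inj₁ w≡u

    extend : ∀ {z y} t → (∃ λ t′ → t′ ≤ t × Walk (adj G⁻) x z t′) → Walk (adj G) z y k →
             ∃ λ k′ → k′ ≤ t + k × Walk (adj G⁻) x y k′
    extend t (t′ , t′≤t , p) here = t′ , ≤-trans t′≤t (m≤m+n t 0) , p
    extend {z = z} {y} t (t′ , t′≤t , p) (step {y = w} {k = k} e q) =
      subst (λ s → ∃ λ k′ → k′ ≤ s × Walk (adj G⁻) x y k′) (sym (+-suc t k)) (extend (suc t) next q)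
      where
      next : ∃ λ t″ → t″ ≤ suc t × Walk (adj G⁻) x w t″
      next with sameEdge? u v z w
      ... | no ¬s = suc t′ , s≤s t′≤t , p ∷ʳʷ edge⇒removed e ¬s
      ... | yes s with via (endpoint s) (mapʷ id removed⇒edge p ∷ʳʷ e)
      ...   | t″ , t″≤ , p′ = t″ , ≤-trans t″≤ (s≤s t′≤t) , p′

  ¬monitors : Connected G → ∀ {x} → Avoidable x u → Avoidable x v → ¬ Monitors G x u v
  ¬monitors conn {x} avᵤ avᵥ (y , changes) with dist G conn x y
  ... | d , isd with avoidable-walk avᵤ avᵥ (proj₁ isd)
  ...   | k′ , k′≤d , p = changes (d , isd , dist-transfer (mapʷ id removed⇒edge) isd p k′≤d)

removed-swap : (G : Graph n) {u v x y : Fin n} → Edge (deleteEdge G u v) x y → Edge (deleteEdge G v u) x y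
removed-swap G e = edge⇒removed G (removed⇒edge G e) (λ s → removed⇒¬same G e (SameEdge-swap s))

nearer-end-avoidable : (G : Graph n) {u v x : Fin n} {d d′ : ℕ} → Edge (adj G) u v →
  IsDist (adj G) x u d → IsDist (adj G) x v d′ → d ≤ d′ → Avoidable G {u} {v} x u
nearer-end-avoidable G e isdᵤ isdᵥ d≤d′ =
  avoidable-by G isdᵤ (shortest-avoids G (edge⇒≢ G e) isdᵤ isdᵥ d≤d′) ≤-refl

farther-end-avoidable : (G : Graph n) {u v x : Fin n} {d d′ : ℕ} → Edge (adj G) u v →
  IsDist (adj G) x u d → IsDist (adj G) x v d′ → d′ ≤ d → Avoidable G {u} {v} x v
farther-end-avoidable G e isdᵤ isdᵥ d′≤d p with nearer-end-avoidable G (edge-sym G e) isdᵥ isdᵤ d′≤d p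
... | t , t≤ , q = t , t≤ , mapʷ id (removed-swap G) q

-- Monitoring

module _ (G : Graph n) {u v : Fin n} where

  unreachable⇒changes : ∀ {x y} → (∀ k → ¬ Walk (deleteEdge G u v) x y k) → DistChanges G u v x y
  unreachable⇒changes unreachable (k , _ , (p , _)) = unreachable k p

  longer⇒changes : ∀ {x y} → Walk (adj G) x y k → (∀ j → Walk (deleteEdge G u v) x y j → k < j) →
                   DistChanges G u v x y
  longer⇒changes p longer (d , isd , (q , _)) = <-irrefl refl (≤-<-trans (dist≤length isd p) (longer d q))

  edge-changesˡ : Edge (adj G) u v → DistChanges G u v u v
  edge-changesˡ e = longer⇒changes (step e here) (λ j q → detour≥2 G e q)

  edge-changesʳ : Edge (adj G) u v → DistChanges G u v v u
  edge-changesʳ e = longer⇒changes (step (edge-sym G e) here)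
                                   (λ j q → detour≥2 G e (reverseʷ (removeEdge G u v) q))

dem<order : (G : Graph n) → 1 ≤ n → IsDem G a → a < n
dem<order G (s≤s z≤n) ((_ , _) , minimal) =
  s≤s (≤-trans (minimal (outside ∷ ⊤) all-but-first) (≤-reflexive (∣⊤∣≡n _)))
  where
  all-but-first : IsDEM G (outside ∷ ⊤)
  all-but-first zero    zero    e = ⊥-elim (edge⇒≢ G e refl)
  all-but-first zero    (suc v) e = suc v , there ∈⊤ , zero , edge-changesʳ G e
  all-but-first (suc u) v       e = suc u , there ∈⊤ , v , edge-changesˡ G e

dem-nonempty : (G : Graph n) → 2 ≤ n → Connected G → ∀ {S} → IsDEM G S → Nonempty S
dem-nonempty G (s≤s (s≤s _)) conn isS with conn zero (suc zero)
... | _ , step e _ = let (s , s∈S , _) = isS _ _ e in s , s∈S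

-- Cycles

module _ {A : Adjacency n} where

  vertex : ∀ {x y} → Walk A x y k → Fin (suc k) → Fin n
  vertex {x = x} p          zero    = x
  vertex         (step e p) (suc i) = vertex p i

  prefix : ∀ {x y} (p : Walk A x y k) (i : Fin (suc k)) → Walk A x (vertex p i) (toℕ i)
  prefix p          zero    = here
  prefix (step e p) (suc i) = step e (prefix p i)

  suffix : ∀ {x y} (p : Walk A x y k) (i : Fin (suc k)) → Walk A (vertex p i) y (k ∸ toℕ i)
  suffix p          zero    = p
  suffix (step e p) (suc i) = suffix p i

  vertex-last : ∀ {x y} (p : Walk A x y k) (i : Fin (suc k)) → toℕ i ≡ k → vertex p i ≡ y
  vertex-last here       zero    _  = refl
  vertex-last (step e p) (suc i) eq = vertex-last p i (suc-injective eq)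

  vertex-step : ∀ {x y} (p : Walk A x y k) (i j : Fin (suc k)) → toℕ j ≡ suc (toℕ i) →
                Edge A (vertex p i) (vertex p j)
  vertex-step (step e p) zero    (suc zero) _  = e
  vertex-step (step e p) (suc i) (suc j)    eq = vertex-step p i j (suc-injective eq)

  shortcut : ∀ {x y} (p : Walk A x y k) (i j : Fin (suc k)) → vertex p i ≡ vertex p j → toℕ i < toℕ j →
             ∃ λ l → l < k × Walk A x y l
  shortcut {k = k} {y = y} p i j eq i<j =
    toℕ i + (k ∸ toℕ j) , length< , prefix p i ++ʷ castʷ (sym eq) refl (suffix p j)
    where
    length< : toℕ i + (k ∸ toℕ j) < k
    length< = subst (toℕ i + (k ∸ toℕ j) <_) (m+[n∸m]≡n (≤-pred (toℕ<n j))) (+-monoˡ-< (k ∸ toℕ j) i<j)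

  shortest⇒injective : ∀ {x y} (p : Walk A x y k) → (∀ j → j < k → ¬ Walk A x y j) →
                       Injective _≡_ _≡_ (vertex p)
  shortest⇒injective p min {i} {j} eq with <-cmp (toℕ i) (toℕ j)
  ... | tri≈ _ i≡j _ = toℕ-injective i≡j
  ... | tri< i<j _ _ = let (l , l<k , q) = shortcut p i j eq i<j in ⊥-elim (min l l<k q)
  ... | tri> _ _ j<i = let (l , l<k , q) = shortcut p j i (sym eq) j<i in ⊥-elim (min l l<k q)

detour⇒cycle : (H : Graph n) {a b : Fin n} → Edge (adj H) a b → Walk (deleteEdge H a b) b a k → Cycle H
detour⇒cycle H {a} {b} e q with dist-exists q
... | L , (p , min) = record
  { len      = suc L
  ; len≥3    = s≤s (detour≥2 H e (reverseʷ (removeEdge H a b) p))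
  ; vs       = tabulate (vertex p)
  ; distinct = λ {i} {j} eq → shortest⇒injective p min (trans (sym (at i)) (trans eq (at j)))
  ; path     = λ i j j≡1+i → subst₂ (Edge (adj H)) (sym (at i)) (sym (at j))
                               (removed⇒edge H (vertex-step p i j j≡1+i))
  ; closing  = λ i j i≡last j≡0 → subst₂ (Edge (adj H))
                 (sym (trans (at i) (vertex-last p i (suc-injective i≡last))))
                 (sym (trans (at j) (cong (vertex p) (toℕ-injective {j = zero} j≡0))))
                 e
  }
  where
  at : ∀ i → lookup (tabulate (vertex p)) i ≡ vertex p i
  at = lookup∘tabulate (vertex p)

acyclic⇒separating : (H : Graph n) → ¬ Cycle H → {x a b : Fin n} {d d′ : ℕ} → Edge (adj H) a b →
  IsDist (adj H) x a d → IsDist (adj H) x b d′ → d ≤ d′ → ¬ Walk (deleteEdge H a b) x b k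
acyclic⇒separating H acyclic {a = a} {b} e isdₐ isd_b d≤d′ q =
  acyclic (detour⇒cycle H e (reverseʷ (removeEdge H a b) q ++ʷ
                             shortest-avoids H (edge⇒≢ H e) isdₐ isd_b d≤d′))

-- p and s index the cycle vertices before and after the one indexed by q.
neighbour-indices-distinct : ∀ {L q p s} → 3 ≤ L → s ≡ suc q ⊎ (s ≡ 0 × suc q ≡ L) →
                             suc p ≡ q ⊎ (q ≡ 0 × suc p ≡ L) → p ≢ s
neighbour-indices-distinct _                  (inj₁ refl)          (inj₁ refl)          ()
neighbour-indices-distinct (s≤s (s≤s ()))     (inj₁ refl)          (inj₂ (refl , refl)) refl
neighbour-indices-distinct (s≤s (s≤s ()))     (inj₂ (refl , refl)) (inj₁ refl)          refl

module _ {H : Graph n} (C : Cycle H) where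
  open Cycle C

  successor : ∀ q → ∃ λ s → Edge (adj H) (lookup vs q) (lookup vs s) ×
                            (toℕ s ≡ suc (toℕ q) ⊎ (toℕ s ≡ 0 × suc (toℕ q) ≡ len))
  successor q with suc (toℕ q) <? len
  ... | yes q+1<len = fromℕ< q+1<len , path q _ (toℕ-fromℕ< q+1<len) , inj₁ (toℕ-fromℕ< q+1<len)
  ... | no  q+1≮len = fromℕ< 0<len , closing q _ q+1≡len (toℕ-fromℕ< 0<len) ,
                      inj₂ (toℕ-fromℕ< 0<len , q+1≡len)
    where
    0<len = ≤-trans (s≤s z≤n) len≥3
    q+1≡len = ≤-antisym (toℕ<n q) (≮⇒≥ q+1≮len)

  predecessor : ∀ q → ∃ λ p → Edge (adj H) (lookup vs p) (lookup vs q) ×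
                              (suc (toℕ p) ≡ toℕ q ⊎ (toℕ q ≡ 0 × suc (toℕ p) ≡ len))
  predecessor q with toℕ q in q≡
  ... | suc t = fromℕ< t<len , path _ q (trans q≡ (cong suc (sym (toℕ-fromℕ< t<len)))) ,
                inj₁ (cong suc (toℕ-fromℕ< t<len))
    where
    t<len = ≤-trans (n≤1+n (suc t)) (subst (_< len) q≡ (toℕ<n q))
  ... | zero  = fromℕ< last<len , closing _ q (trans (cong suc (toℕ-fromℕ< last<len)) last+1≡len) q≡ ,
                inj₂ (refl , trans (cong suc (toℕ-fromℕ< last<len)) last+1≡len)
    where
    last+1≡len : suc (len ∸ 1) ≡ len
    last+1≡len = m+[n∸m]≡n (≤-trans (s≤s z≤n) len≥3)
    last<len : len ∸ 1 < len
    last<len = ≤-reflexive last+1≡len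

  neighbours : ∀ q → ∃₂ λ p s → Edge (adj H) (lookup vs p) (lookup vs q) ×
                               Edge (adj H) (lookup vs q) (lookup vs s) × lookup vs p ≢ lookup vs s
  neighbours q with predecessor q | successor q
  ... | p , eₚ , p-index | s , eₛ , s-index =
    p , s , eₚ , eₛ , λ eq → neighbour-indices-distinct len≥3 s-index p-index (cong toℕ (distinct eq))

argmax : ∀ {L} → 0 < L → (F : Fin L → ℕ) → ∃ λ q → ∀ p → F p ≤ F q
argmax {suc zero}    _ F = zero , λ { zero → ≤-refl }
argmax {suc (suc L)} _ F with argmax (s≤s z≤n) (λ p → F (suc p))
... | q , max with F zero ≤? F (suc q)
...   | yes F0≤ = suc q , λ { zero → F0≤ ; (suc p) → max p }
...   | no  F0≰ = zero , λ { zero → ≤-refl ; (suc p) → ≤-trans (max p) (<⇒≤ (≰⇒> F0≰)) }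

-- Take a cycle vertex q farthest from r, with cycle neighbours p and s. If p or s is as far
-- from r as q, that edge to q works; otherwise pq works, q being reached through s.
module _ (H : Graph n) (conn : Connected H) (C : Cycle H) (r : Fin n) where
  open Cycle C
  private
    at : Fin len → Fin n
    at = lookup vs

    δ : Fin len → ℕ
    δ q = proj₁ (dist H conn r (at q))

    isδ : ∀ q → IsDist (adj H) r (at q) (δ q)
    isδ q = proj₂ (dist H conn r (at q))

  cycle⇒avoidable-edge : ∃₂ λ c c′ → Edge (adj H) c c′ ×
                                    Avoidable H {c} {c′} r c × Avoidable H {c} {c′} r c′
  cycle⇒avoidable-edge with argmax (≤-trans (s≤s z≤n) len≥3) δ
  ... | q , max with neighbours C q
  ...   | p , s , eₚ , eₛ , p≢s with δ q ≤? δ p | δ q ≤? δ s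
  ...     | yes q≤p | _       = at p , at q , eₚ , nearer-end-avoidable H eₚ (isδ p) (isδ q) (max p) ,
                                                 farther-end-avoidable H eₚ (isδ p) (isδ q) q≤p
  ...     | no _    | yes q≤s = at q , at s , eₛ , nearer-end-avoidable H eₛ (isδ q) (isδ s) q≤s ,
                                                 farther-end-avoidable H eₛ (isδ q) (isδ s) (max s)
  ...     | no _    | no q≰s  = at p , at q , eₚ , nearer-end-avoidable H eₚ (isδ p) (isδ q) (max p) ,
    avoidable-by H (isδ q) (shortest-avoids H s≢q (isδ s) (isδ q) (max s) ∷ʳʷ
                            edge⇒removed H (edge-sym H eₛ) ¬same)
                   (≰⇒> q≰s)
    where
    s≢q : at s ≢ at q
    s≢q s≡q = edge⇒≢ H eₛ (sym s≡q)
    ¬same : ¬ SameEdge (at p) (at q) (at s) (at q)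
    ¬same (inj₁ (s≡p , _)) = p≢s (sym s≡p)
    ¬same (inj₂ (s≡q , _)) = s≢q s≡q

-- Counting

indicator : Bool → ℕ
indicator true  = 1
indicator false = 0

∑ : (Fin k → ℕ) → ℕ
∑ {zero}  f = 0
∑ {suc k} f = f zero + ∑ (f ∘ suc)

∑-mono-≤ : {f g : Fin k → ℕ} → (∀ i → f i ≤ g i) → ∑ f ≤ ∑ g
∑-mono-≤ {zero}  f≤g = z≤n
∑-mono-≤ {suc k} f≤g = +-mono-≤ (f≤g zero) (∑-mono-≤ (f≤g ∘ suc))

∑-cong : {f g : Fin k → ℕ} → (∀ i → f i ≡ g i) → ∑ f ≡ ∑ g
∑-cong {zero}  f≗g = refl
∑-cong {suc k} f≗g = cong₂ _+_ (f≗g zero) (∑-cong (f≗g ∘ suc))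

∑-const : ∀ k c → ∑ {k} (λ _ → c) ≡ k * c
∑-const zero    c = refl
∑-const (suc k) c = cong (c +_) (∑-const k c)

∑-++ : ∀ k (f : Fin (k + l) → ℕ) → ∑ f ≡ ∑ (λ i → f (i ↑ˡ l)) + ∑ (λ j → f (k ↑ʳ j))
∑-++ zero    f = refl
∑-++ (suc k) f = trans (cong (f zero +_) (∑-++ k (f ∘ suc))) (sym (+-assoc (f zero) _ _))

∑-combine : ∀ m (f : Fin (m * n) → ℕ) → ∑ f ≡ ∑ {m} (λ i → ∑ {n} (λ j → f (combine i j)))
∑-combine zero        f = refl
∑-combine {n} (suc m) f =
  trans (∑-++ n f) (cong (∑ (λ j → f (j ↑ˡ (m * n))) +_) (∑-combine m (f ∘ (n ↑ʳ_))))

∣p∣≡∑ : (p : Subset k) → ∣ p ∣ ≡ ∑ (indicator ∘ lookup p)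
∣p∣≡∑ []          = refl
∣p∣≡∑ (true ∷ p)  = cong suc (∣p∣≡∑ p)
∣p∣≡∑ (false ∷ p) = ∣p∣≡∑ p

∈⇒lookup : {x : Fin k} {p : Subset k} → x ∈ p → lookup p x ≡ true
∈⇒lookup = []=⇒lookup

lookup⇒∈ : {x : Fin k} {p : Subset k} → lookup p x ≡ true → x ∈ p
lookup⇒∈ {x = x} {p} = lookup⇒[]= x p

∈⇒1≤∣∣ : {x : Fin k} {p : Subset k} → x ∈ p → 1 ≤ ∣ p ∣
∈⇒1≤∣∣ x∈p = ≤-trans (s≤s z≤n) (x∈p⇒∣p-x∣<∣p∣ x∈p)

-- A subset of Fin (m * n) read as m rows of subsets of Fin n, row i holding the indices combine i j.
module Rows (m n : ℕ) where

  row : Subset (m * n) → Fin m → Subset n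
  row M i = tabulate (λ j → lookup M (combine i j))

  fromRows : (Fin m → Subset n) → Subset (m * n)
  fromRows R = tabulate (λ x → let (i , j) = remQuot {m} n x in lookup (R i) j)

  ∈-row : ∀ {M : Subset (m * n)} {i : Fin m} {j : Fin n} → combine i j ∈ M → j ∈ row M i
  ∈-row {i = i} {j} ij∈M = lookup⇒∈ (trans (lookup∘tabulate _ j) (∈⇒lookup ij∈M))

  row-fromRows : ∀ (R : Fin m → Subset n) i → row (fromRows R) i ≡ R i
  row-fromRows R i = trans (tabulate-cong entry) (tabulate∘lookup (R i))
    where
    entry : ∀ j → lookup (fromRows R) (combine i j) ≡ lookup (R i) j
    entry j = trans (lookup∘tabulate _ (combine i j)) (cong (λ (i , j) → lookup (R i) j) (remQuot-combine i j))

  ∈-fromRows : ∀ (R : Fin m → Subset n) {i : Fin m} {j : Fin n} → j ∈ R i → combine i j ∈ fromRows R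
  ∈-fromRows R {i} {j} j∈Ri =
    lookup⇒∈ (trans (sym (lookup∘tabulate _ j))
                    (trans (cong (λ p → lookup p j) (row-fromRows R i)) (∈⇒lookup j∈Ri)))

  ∣M∣≡∑rows : ∀ (M : Subset (m * n)) → ∣ M ∣ ≡ ∑ (λ i → ∣ row M i ∣)
  ∣M∣≡∑rows M = trans (∣p∣≡∑ M) (trans (∑-combine m _) (∑-cong (λ i → sym (row-size i))))
    where
    row-size : ∀ i → ∣ row M i ∣ ≡ ∑ {n} (λ j → indicator (lookup M (combine i j)))
    row-size i = trans (∣p∣≡∑ (row M i))
                       (∑-cong (λ j → cong indicator (lookup∘tabulate (λ j → lookup M (combine i j)) j)))

  ∣fromRows∣ : ∀ (R : Fin m → Subset n) → ∣ fromRows R ∣ ≡ ∑ (λ i → ∣ R i ∣)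
  ∣fromRows∣ R = trans (∣M∣≡∑rows (fromRows R)) (∑-cong (λ i → cong ∣_∣ (row-fromRows R i)))

-- Retractions and the rooted product

Shortens : (Fin n → Fin n′) → Adjacency n → Adjacency n′ → Set
Shortens f A B = ∀ {x y k} → Walk A x y k → ∃ λ k′ → k′ ≤ k × Walk B (f x) (f y) k′

Embeds : (Fin n′ → Fin n) → Adjacency n′ → Adjacency n → Set
Embeds g B A = ∀ {x y} → Edge B x y → Edge A (g x) (g y)

module _ {A : Adjacency n} {B : Adjacency n′} (f : Fin n → Fin n′) (g : Fin n′ → Fin n)
         (f∘g≗id : ∀ x → f (g x) ≡ x) where

  retract-dist : Embeds g B A → Shortens f A B → ∀ {x y} → IsDist A (g x) (g y) d → IsDist B x y d
  retract-dist embeds shortens isd with shortens (proj₁ isd)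
  ... | k′ , k′≤d , p = dist-transfer (mapʷ g embeds) isd (castʷ (f∘g≗id _) (f∘g≗id _) p) k′≤d

module _ (K : Graph n′) (G : Graph n) (f : Fin n → Fin n′) (g : Fin n′ → Fin n)
         (f∘g≗id : ∀ x → f (g x) ≡ x) {u v : Fin n′} where

  retract-monitors : Embeds g (adj K) (adj G) → Shortens f (adj G) (adj K) →
                     Embeds g (deleteEdge K u v) (deleteEdge G (g u) (g v)) →
                     Shortens f (deleteEdge G (g u) (g v)) (deleteEdge K u v) →
                     ∀ {s} → Monitors K s u v → Monitors G (g s) (g u) (g v)
  retract-monitors embeds shortens embeds⁻ shortens⁻ (y , changes) =
    g y , λ { (k , isd , isd⁻) → changes (k , retract-dist f g f∘g≗id embeds shortens isd
                                             , retract-dist f g f∘g≗id embeds⁻ shortens⁻ isd⁻) }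

module RootedProduct {m n : ℕ} (G : Graph m) (H : Graph n) (r : Fin n) where

  X : Graph (m * n)
  X = G ⊙ H at r

  ⟨_,_⟩ : Fin m → Fin n → Fin (m * n)
  ⟨ i , j ⟩ = combine i j

  copyOf : Fin (m * n) → Fin m
  copyOf x = proj₁ (remQuot {m} n x)

  posOf : Fin (m * n) → Fin n
  posOf x = proj₂ (remQuot {m} n x)

  copyOf-⟨⟩ : ∀ i j → copyOf ⟨ i , j ⟩ ≡ i
  copyOf-⟨⟩ i j = cong proj₁ (remQuot-combine i j)

  posOf-⟨⟩ : ∀ i j → posOf ⟨ i , j ⟩ ≡ j
  posOf-⟨⟩ i j = cong proj₂ (remQuot-combine i j)

  ⟨⟩-unique : ∀ {x i j} → copyOf x ≡ i → posOf x ≡ j → x ≡ ⟨ i , j ⟩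
  ⟨⟩-unique {x} refl refl = sym (combine-remQuot {m} n x)

  ⟨⟩-injective : ∀ {i i′ j j′} → ⟨ i , j ⟩ ≡ ⟨ i′ , j′ ⟩ → (i , j) ≡ (i′ , j′)
  ⟨⟩-injective {i} {i′} {j} {j′} eq =
    trans (sym (remQuot-combine i j)) (trans (cong (remQuot {m} n) eq) (remQuot-combine i′ j′))

  SameEdge-⟨⟩ : ∀ {i i′ l l′ j j′ a b} → SameEdge ⟨ i , j ⟩ ⟨ i′ , j′ ⟩ ⟨ l , a ⟩ ⟨ l′ , b ⟩ →
                SameEdge (i , j) (i′ , j′) (l , a) (l′ , b)
  SameEdge-⟨⟩ = SameEdge-reflect ⟨⟩-injective

  adj-⟨⟩ : ∀ i j i′ j′ → adj X ⟨ i , j ⟩ ⟨ i′ , j′ ⟩ ≡ prodAdjPair G H r (i , j) (i′ , j′)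
  adj-⟨⟩ i j i′ j′ = cong₂ (prodAdjPair G H r) (remQuot-combine i j) (remQuot-combine i′ j′)

  copy-edge : ∀ {i j j′} → Edge (adj H) j j′ → Edge (adj X) ⟨ i , j ⟩ ⟨ i , j′ ⟩
  copy-edge {i} {j} {j′} e rewrite adj-⟨⟩ i j i j′ | ==-refl i | e = refl

  root-edge : ∀ {i k} → Edge (adj G) i k → Edge (adj X) ⟨ i , r ⟩ ⟨ k , r ⟩
  root-edge {i} {k} e rewrite adj-⟨⟩ i r k r | ==-refl r | e = Bool.∨-zeroʳ _

  CopyOrRootEdge : Fin (m * n) → Fin (m * n) → Set
  CopyOrRootEdge x y = (copyOf x ≡ copyOf y × Edge (adj H) (posOf x) (posOf y)) ⊎
                       (posOf x ≡ r × posOf y ≡ r × Edge (adj G) (copyOf x) (copyOf y))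

  edge-cases : ∀ {x y} → Edge (adj X) x y → CopyOrRootEdge x y
  edge-cases {x} {y} = pair-cases (remQuot {m} n x) (remQuot {m} n y)
    where
    pair-cases : ∀ p q → prodAdjPair G H r p q ≡ true →
      (proj₁ p ≡ proj₁ q × Edge (adj H) (proj₂ p) (proj₂ q)) ⊎
      (proj₂ p ≡ r × proj₂ q ≡ r × Edge (adj G) (proj₁ p) (proj₁ q))
    pair-cases (i , j) (i′ , j′) e with ∨-true {(i == i′) ∧ adj H j j′} e
    ... | inj₁ e₁ = let (i≡i′ , h) = ∧-true e₁ in inj₁ (==⇒≡ i≡i′ , h)
    ... | inj₂ e₂ = let (roots , g) = ∧-true e₂
                        (j≡r , j′≡r) = ∧-true {j == r} roots
                    in inj₂ (==⇒≡ j≡r , ==⇒≡ j′≡r , g)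

  in-copy : ∀ i {j j′ k} → Walk (adj H) j j′ k → Walk (adj X) ⟨ i , j ⟩ ⟨ i , j′ ⟩ k
  in-copy i = mapʷ ⟨ i ,_⟩ copy-edge

  at-root : ∀ {i i′ k} → Walk (adj G) i i′ k → Walk (adj X) ⟨ i , r ⟩ ⟨ i′ , r ⟩ k
  at-root = mapʷ ⟨_, r ⟩ root-edge

  X-connected : Connected G → Connected H → Connected X
  X-connected connG connH x y =
    _ , castʷ (sym (⟨⟩-unique refl refl)) (sym (⟨⟩-unique refl refl))
              (in-copy (copyOf x) (proj₂ (connH (posOf x) r)) ++ʷ
               at-root (proj₂ (connG (copyOf x) (copyOf y))) ++ʷ
               in-copy (copyOf y) (proj₂ (connH r (posOf y))))

  posIn : Fin m → Fin (m * n) → Fin n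
  posIn l x with copyOf x ≟ l
  ... | yes _ = posOf x
  ... | no  _ = r

  posIn-inside : ∀ {l x} → copyOf x ≡ l → posIn l x ≡ posOf x
  posIn-inside {l} {x} cx≡l with copyOf x ≟ l
  ... | yes _    = refl
  ... | no cx≢l  = ⊥-elim (cx≢l cx≡l)

  posIn-outside : ∀ {l x} → copyOf x ≢ l → posIn l x ≡ r
  posIn-outside {l} {x} cx≢l with copyOf x ≟ l
  ... | yes cx≡l = ⊥-elim (cx≢l cx≡l)
  ... | no _     = refl

  posIn-root : ∀ {l x} → posOf x ≡ r → posIn l x ≡ r
  posIn-root {l} {x} px≡r with copyOf x ≟ l
  ... | yes _ = px≡r
  ... | no  _ = refl

  posIn-⟨⟩ : ∀ i j → posIn i ⟨ i , j ⟩ ≡ j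
  posIn-⟨⟩ i j = trans (posIn-inside (copyOf-⟨⟩ i j)) (posOf-⟨⟩ i j)

  posIn-root-⟨⟩ : ∀ l i → posIn l ⟨ i , r ⟩ ≡ r
  posIn-root-⟨⟩ l i = posIn-root (posOf-⟨⟩ i r)

  -- Collapsing copy i onto its root turns a walk into one that avoids every edge of copy i.
  collapse : Fin m → Fin (m * n) → Fin (m * n)
  collapse i x with copyOf x ≟ i
  ... | yes _ = ⟨ i , r ⟩
  ... | no  _ = x

  collapse-inside : ∀ {i x} → copyOf x ≡ i → collapse i x ≡ ⟨ i , r ⟩
  collapse-inside {i} {x} cx≡i with copyOf x ≟ i
  ... | yes _   = refl
  ... | no cx≢i = ⊥-elim (cx≢i cx≡i)

  collapse-fixes : ∀ {i x} → posIn i x ≡ r → collapse i x ≡ x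
  collapse-fixes {i} {x} at-root with copyOf x ≟ i | at-root
  ... | yes cx≡i | px≡r = sym (⟨⟩-unique cx≡i px≡r)
  ... | no _     | _    = refl

  module Split {A : Adjacency (m * n)} {B : Adjacency n} {C : Adjacency m}
               (A⇒X : ∀ {x y} → Edge A x y → Edge (adj X) x y) (l : Fin m)
               (copy-step : ∀ {x y} → Edge A x y → copyOf x ≡ l → copyOf y ≡ l →
                            Edge (adj H) (posOf x) (posOf y) → Edge B (posOf x) (posOf y))
               (root-step : ∀ {x y} → Edge A x y → posOf x ≡ r → posOf y ≡ r →
                            Edge (adj G) (copyOf x) (copyOf y) → Edge C (copyOf x) (copyOf y)) where

    steps-split : ∀ {x y} → Edge A x y → SplitStep B C (posIn l) copyOf x y
    steps-split {x} {y} e = by-cases (edge-cases (A⇒X e)) (copyOf x ≟ l)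
      where
      by-cases : CopyOrRootEdge x y → Dec (copyOf x ≡ l) → SplitStep B C (posIn l) copyOf x y
      by-cases (inj₂ (px≡r , py≡r , g)) _ =
        inj₂ (inj₁ (trans (posIn-root px≡r) (sym (posIn-root py≡r)) , root-step e px≡r py≡r g))
      by-cases (inj₁ (cx≡cy , h)) (no cx≢l) =
        inj₂ (inj₂ (trans (posIn-outside cx≢l) (sym (posIn-outside (cx≢l ∘ trans cx≡cy))) , cx≡cy))
      by-cases (inj₁ (cx≡cy , h)) (yes cx≡l) =
        inj₁ (subst₂ (Edge B) (sym (posIn-inside cx≡l)) (sym (posIn-inside cy≡l)) (copy-step e cx≡l cy≡l h) ,
              cx≡cy)
        where
        cy≡l : copyOf y ≡ l
        cy≡l = trans (sym cx≡cy) cx≡l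

    split : ∀ {x y} → Walk A x y k →
            ∃₂ λ a b → a + b ≤ k × Walk B (posIn l x) (posIn l y) a × Walk C (copyOf x) (copyOf y) b
    split = splitʷ (posIn l) copyOf steps-split

    shortens-to-copy : Shortens (posIn l) A B
    shortens-to-copy p with split p
    ... | a , b , a+b≤k , p₁ , _ = a , ≤-trans (m≤m+n a b) a+b≤k , p₁

    shortens-to-G : Shortens copyOf A C
    shortens-to-G p with split p
    ... | a , b , a+b≤k , _ , p₂ = b , ≤-trans (m≤n+m b a) a+b≤k , p₂

  module SplitX (l : Fin m) = Split {B = adj H} {C = adj G} id l (λ _ _ _ h → h) (λ _ _ _ g → g)

  module CopyEdgeRemoved (i : Fin m) {j j′ : Fin n} where
    X⁻ : Graph (m * n)
    X⁻ = removeEdge X ⟨ i , j ⟩ ⟨ i , j′ ⟩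

    H⁻ : Graph n
    H⁻ = removeEdge H j j′

    in-copy-edge : ∀ {a b} → Edge (adj H⁻) a b → Edge (adj X⁻) ⟨ i , a ⟩ ⟨ i , b ⟩
    in-copy-edge e = edge⇒removed X (copy-edge (removed⇒edge H e))
                                    (removed⇒¬same H e ∘ SameEdge-map proj₂ ∘ SameEdge-⟨⟩)

    copy-step : ∀ {x y} → Edge (adj X⁻) x y → copyOf x ≡ i → copyOf y ≡ i →
                Edge (adj H) (posOf x) (posOf y) → Edge (adj H⁻) (posOf x) (posOf y)
    copy-step e cx≡i cy≡i h = edge⇒removed H h λ same →
      removed⇒¬same X e (SameEdge-subst (sym (⟨⟩-unique cx≡i refl)) (sym (⟨⟩-unique cy≡i refl))
                                        (SameEdge-map ⟨ i ,_⟩ same))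

    open Split {B = adj H⁻} {C = adj G} (removed⇒edge X) i copy-step (λ _ _ _ g → g) public

    from-root : ∀ {l y k} → Walk (adj X⁻) ⟨ l , r ⟩ ⟨ i , y ⟩ k → ∃ λ k′ → Walk (adj H⁻) r y k′
    from-root {l} {y} p with shortens-to-copy p
    ... | k′ , _ , q = k′ , castʷ (posIn-root-⟨⟩ i l) (posIn-⟨⟩ i y) q

    inside-copy : ∀ {x y} → SameEdge ⟨ i , j ⟩ ⟨ i , j′ ⟩ x y → copyOf x ≡ i × copyOf y ≡ i
    inside-copy = SameEdge-within (copyOf-⟨⟩ i j) (copyOf-⟨⟩ i j′) ∘ SameEdge-map copyOf

    collapse-steps : ∀ {x y} → Edge (adj X) x y → SplitStep (adj H) (adj X⁻) (posIn i) (collapse i) x y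
    collapse-steps {x} {y} e = by-cases (edge-cases e) (copyOf x ≟ i)
      where
      kept : posIn i x ≡ r → posIn i y ≡ r → ¬ SameEdge ⟨ i , j ⟩ ⟨ i , j′ ⟩ x y →
             SplitStep (adj H) (adj X⁻) (posIn i) (collapse i) x y
      kept px≡r py≡r ¬same = inj₂ (inj₁ (trans px≡r (sym py≡r) ,
        subst₂ (Edge (adj X⁻)) (sym (collapse-fixes px≡r)) (sym (collapse-fixes py≡r))
               (edge⇒removed X e ¬same)))

      by-cases : CopyOrRootEdge x y → Dec (copyOf x ≡ i) → SplitStep (adj H) (adj X⁻) (posIn i) (collapse i) x y
      by-cases (inj₂ (px≡r , py≡r , g)) _ =
        kept (posIn-root px≡r) (posIn-root py≡r)
             (λ same → let (cx≡i , cy≡i) = inside-copy same in edge⇒≢ G g (trans cx≡i (sym cy≡i)))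
      by-cases (inj₁ (cx≡cy , h)) (no cx≢i) =
        kept (posIn-outside cx≢i) (posIn-outside (cx≢i ∘ trans cx≡cy)) (cx≢i ∘ proj₁ ∘ inside-copy)
      by-cases (inj₁ (cx≡cy , h)) (yes cx≡i) =
        inj₁ (subst₂ (Edge (adj H)) (sym (posIn-inside cx≡i)) (sym (posIn-inside cy≡i)) h ,
              trans (collapse-inside cx≡i) (sym (collapse-inside cy≡i)))
        where
        cy≡i : copyOf y ≡ i
        cy≡i = trans (sym cx≡cy) cx≡i

    avoidable-from-outside : ∀ {x w} → copyOf x ≢ i → Avoidable H {j} {j′} r w →
                             Avoidable X {⟨ i , j ⟩} {⟨ i , j′ ⟩} x ⟨ i , w ⟩
    avoidable-from-outside {x} {w} cx≢i av p with splitʷ (posIn i) (collapse i) collapse-steps p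
    ... | a , b , a+b≤t , p₁ , p₂ with av (castʷ (posIn-outside cx≢i) (posIn-⟨⟩ i w) p₁)
    ...   | a′ , a′≤a , q =
      b + a′ , ≤-trans (≤-trans (+-monoʳ-≤ b a′≤a) (≤-reflexive (+-comm b a))) a+b≤t ,
      castʷ (collapse-fixes (posIn-outside cx≢i)) (collapse-inside (copyOf-⟨⟩ i w)) p₂ ++ʷ
      mapʷ ⟨ i ,_⟩ in-copy-edge q

  module RootEdgeRemoved {i k : Fin m} (e : Edge (adj G) i k) where
    X⁻ : Graph (m * n)
    X⁻ = removeEdge X ⟨ i , r ⟩ ⟨ k , r ⟩

    G⁻ : Graph m
    G⁻ = removeEdge G i k

    at-root-edge : ∀ {a b} → Edge (adj G⁻) a b → Edge (adj X⁻) ⟨ a , r ⟩ ⟨ b , r ⟩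
    at-root-edge e⁻ = edge⇒removed X (root-edge (removed⇒edge G e⁻))
                                     (removed⇒¬same G e⁻ ∘ SameEdge-map proj₁ ∘ SameEdge-⟨⟩)

    in-copy-edge : ∀ {l a b} → Edge (adj H) a b → Edge (adj X⁻) ⟨ l , a ⟩ ⟨ l , b ⟩
    in-copy-edge h = edge⇒removed X (copy-edge h)
                                    (edge⇒≢ G e ∘ SameEdge-loop ∘ SameEdge-map proj₁ ∘ SameEdge-⟨⟩)

    root-step : ∀ {x y} → Edge (adj X⁻) x y → posOf x ≡ r → posOf y ≡ r →
                Edge (adj G) (copyOf x) (copyOf y) → Edge (adj G⁻) (copyOf x) (copyOf y)
    root-step e⁻ px≡r py≡r g = edge⇒removed G g λ same →
      removed⇒¬same X e⁻ (SameEdge-subst (sym (⟨⟩-unique refl px≡r)) (sym (⟨⟩-unique refl py≡r))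
                                         (SameEdge-map ⟨_, r ⟩ same))

    module S (l : Fin m) = Split {B = adj H} {C = adj G⁻} (removed⇒edge X) l (λ _ _ _ h → h) root-step

  copy-monitors : ∀ i {s j j′} → Monitors H s j j′ → Monitors X ⟨ i , s ⟩ ⟨ i , j ⟩ ⟨ i , j′ ⟩
  copy-monitors i {j = j} {j′} =
    retract-monitors H X (posIn i) ⟨ i ,_⟩ (posIn-⟨⟩ i) copy-edge (SplitX.shortens-to-copy i)
                     in-copy-edge shortens-to-copy
    where open CopyEdgeRemoved i {j} {j′}

  root-monitors : ∀ {l i k} → Edge (adj G) i k → Monitors G l i k → Monitors X ⟨ l , r ⟩ ⟨ i , r ⟩ ⟨ k , r ⟩
  root-monitors {i = i} e =
    retract-monitors G X copyOf ⟨_, r ⟩ (λ a → copyOf-⟨⟩ a r) root-edge (SplitX.shortens-to-G i)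
                     at-root-edge (S.shortens-to-G i)
    where open RootEdgeRemoved e

  -- Without the edge, a walk from copy i to ⟨ k , r ⟩ still passes ⟨ i , r ⟩ and then
  -- detours around ik in G.
  copy-monitors-root-edge : Connected H → ∀ {i k} s → Edge (adj G) i k →
                            Monitors X ⟨ i , s ⟩ ⟨ i , r ⟩ ⟨ k , r ⟩
  copy-monitors-root-edge connH {i} {k} s e with dist H connH s r
  ... | δ , isδ = ⟨ k , r ⟩ , longer⇒changes X (in-copy i (proj₁ isδ) ++ʷ step (root-edge e) here) longer
    where
    open RootEdgeRemoved e
    longer : ∀ j → Walk (adj X⁻) ⟨ i , s ⟩ ⟨ k , r ⟩ j → δ + 1 < j
    longer j p with S.split i p
    ... | a , b , a+b≤j , p₁ , p₂ = begin-strict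
      δ + 1  <⟨ +-monoʳ-< δ ≤-refl ⟩
      δ + 2  ≤⟨ +-mono-≤ (dist≤length isδ (castʷ (posIn-⟨⟩ i s) (posIn-root-⟨⟩ i k) p₁))
                         (detour≥2 G e (castʷ (copyOf-⟨⟩ i s) (copyOf-⟨⟩ k r) p₂)) ⟩
      a + b  ≤⟨ a+b≤j ⟩
      j      ∎
      where open ≤-Reasoning

  -- If d_G(copyOf x, ·) survives the removal of ik at both i and k, then x reaches both
  -- ends of ⟨ i , r ⟩⟨ k , r ⟩ by leaving its copy and following a surviving G-route.
  root-edge-monitor : Connected G → Connected H → ∀ {x i k} → Edge (adj G) i k →
                      Monitors X x ⟨ i , r ⟩ ⟨ k , r ⟩ → Monitors G (copyOf x) i k
  root-edge-monitor connG connH {x} {i} {k} e mon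
    with changes⊎avoidable G {i} {k} connG (copyOf x) i | changes⊎avoidable G {i} {k} connG (copyOf x) k
  ... | inj₁ changesᵢ | _            = i , changesᵢ
  ... | inj₂ _        | inj₁ changesₖ = k , changesₖ
  ... | inj₂ avᵢ      | inj₂ avₖ     = ⊥-elim (¬monitors X (X-connected connG connH) (lift avᵢ) (lift avₖ) mon)
    where
    open RootEdgeRemoved e
    lift : ∀ {c} → Avoidable G {i} {k} (copyOf x) c → Avoidable X {⟨ i , r ⟩} {⟨ k , r ⟩} x ⟨ c , r ⟩
    lift {c} av p with SplitX.split (copyOf x) p
    ... | a , b , a+b≤t , p₁ , p₂ with av (castʷ refl (copyOf-⟨⟩ c r) p₂)
    ...   | b′ , b′≤b , q =
      a + b′ , ≤-trans (+-monoʳ-≤ a b′≤b) a+b≤t ,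
      castʷ (sym (⟨⟩-unique refl refl)) refl
            (mapʷ ⟨ copyOf x ,_⟩ in-copy-edge (castʷ (posIn-inside refl) (posIn-root-⟨⟩ (copyOf x) c) p₁) ++ʷ
             mapʷ ⟨_, r ⟩ at-root-edge q)

  -- In a tree every edge is a bridge, so removing a copy edge disconnects the copy.
  tree-copy-edge-monitored : IsTree H → ∀ {j j′} → Edge (adj H) j j′ → ∀ i l →
                             Monitors X ⟨ l , r ⟩ ⟨ i , j ⟩ ⟨ i , j′ ⟩
  tree-copy-edge-monitored (connH , acyclic) {j} {j′} e i l
    with dist H connH r j | dist H connH r j′
  ... | δ , isδ | δ′ , isδ′ with ≤-<-connex δ δ′
  ...   | inj₁ δ≤δ′ = ⟨ i , j′ ⟩ , unreachable⇒changes X λ k p →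
      let (_ , q) = from-root p in acyclic⇒separating H acyclic e isδ isδ′ δ≤δ′ q
    where open CopyEdgeRemoved i {j} {j′}
  ...   | inj₂ δ′<δ = ⟨ i , j ⟩ , unreachable⇒changes X λ k p →
      let (_ , q) = from-root p in
      acyclic⇒separating H acyclic (edge-sym H e) isδ′ isδ (<⇒≤ δ′<δ) (mapʷ id (removed-swap H) q)
    where open CopyEdgeRemoved i {j} {j′}

  outside-¬monitors : Connected G → Connected H → ∀ {i c c′ x} →
                      Avoidable H {c} {c′} r c → Avoidable H {c} {c′} r c′ → copyOf x ≢ i →
                      ¬ Monitors X x ⟨ i , c ⟩ ⟨ i , c′ ⟩
  outside-¬monitors connG connH {i} avᶜ avᶜ′ cx≢i =
    ¬monitors X (X-connected connG connH) (avoidable-from-outside cx≢i avᶜ)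
                                          (avoidable-from-outside cx≢i avᶜ′)
    where open CopyEdgeRemoved i

module Bounds {m n : ℕ} (G : Graph m) (H : Graph n) (r : Fin n) (connG : Connected G) (connH : Connected H) where
  open RootedProduct G H r
  open Rows m n
  open ≤-Reasoning

  monitors-cong : ∀ {s x x′ y y′} → x ≡ x′ → y ≡ y′ → Monitors X s x y → Monitors X s x′ y′
  monitors-cong refl refl mon = mon

  copies : Subset n → Subset (m * n)
  copies S = fromRows (λ _ → S)

  dem-copies : ∀ {S} → Nonempty S → IsDEM H S → IsDEM X (copies S)
  dem-copies {S} (s , s∈S) isS x y e with edge-cases e
  ... | inj₁ (cx≡cy , h) =
    let (t , t∈S , mon) = isS (posOf x) (posOf y) h in
    ⟨ copyOf x , t ⟩ , ∈-fromRows (λ _ → S) t∈S ,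
    monitors-cong (sym (⟨⟩-unique refl refl)) (sym (⟨⟩-unique (sym cx≡cy) refl)) (copy-monitors (copyOf x) mon)
  ... | inj₂ (px≡r , py≡r , g) =
    ⟨ copyOf x , s ⟩ , ∈-fromRows (λ _ → S) s∈S ,
    monitors-cong (sym (⟨⟩-unique refl px≡r)) (sym (⟨⟩-unique refl py≡r)) (copy-monitors-root-edge connH s g)

  ∣copies∣ : ∀ S → ∣ copies S ∣ ≡ m * ∣ S ∣
  ∣copies∣ S = trans (∣fromRows∣ (λ _ → S)) (∑-const m ∣ S ∣)

  dem⊙≤order*dem : 2 ≤ n → IsDem X b → IsDem H c → b ≤ m * c
  dem⊙≤order*dem {b = b} {c = c} 2≤n (_ , minX) ((S , isS , ∣S∣≡c) , _) = begin
    b              ≤⟨ minX _ (dem-copies (dem-nonempty H 2≤n connH isS) isS) ⟩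
    ∣ copies S ∣   ≡⟨ ∣copies∣ S ⟩
    m * ∣ S ∣      ≡⟨ cong (m *_) ∣S∣≡c ⟩
    m * c          ∎

  projection : Subset (m * n) → Subset m
  projection M = tabulate (λ i → does (nonempty? (row M i)))

  dem-projection : ∀ {M} → IsDEM X M → IsDEM G (projection M)
  dem-projection {M} isM i k e with isM ⟨ i , r ⟩ ⟨ k , r ⟩ (root-edge e)
  ... | x , x∈M , mon = copyOf x , copy∈projection , root-edge-monitor connG connH e mon
    where
    copy∈projection : copyOf x ∈ projection M
    copy∈projection = lookup⇒∈ (trans (lookup∘tabulate _ (copyOf x))
      (dec-true (nonempty? (row M (copyOf x))) (posOf x , ∈-row (subst (_∈ M) (⟨⟩-unique refl refl) x∈M))))

  ∣projection∣≤ : ∀ M → ∣ projection M ∣ ≤ ∣ M ∣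
  ∣projection∣≤ M = begin
    ∣ projection M ∣                        ≡⟨ ∣p∣≡∑ (projection M) ⟩
    ∑ (indicator ∘ lookup (projection M))   ≤⟨ ∑-mono-≤ row-bound ⟩
    ∑ (λ i → ∣ row M i ∣)                   ≡⟨ ∣M∣≡∑rows M ⟨
    ∣ M ∣                                   ∎
    where
    nonempty-bound : ∀ {k} (p : Subset k) → indicator (does (nonempty? p)) ≤ ∣ p ∣
    nonempty-bound p with nonempty? p
    ... | yes (_ , x∈p) = ∈⇒1≤∣∣ x∈p
    ... | no _          = z≤n
    row-bound : ∀ i → indicator (lookup (projection M) i) ≤ ∣ row M i ∣
    row-bound i rewrite lookup∘tabulate (λ i → does (nonempty? (row M i))) i = nonempty-bound (row M i)

  dem≤dem⊙ : IsDem G a → IsDem X b → a ≤ b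
  dem≤dem⊙ {a = a} {b = b} (_ , minG) ((M , isM , ∣M∣≡b) , _) = begin
    a                  ≤⟨ minG _ (dem-projection isM) ⟩
    ∣ projection M ∣   ≤⟨ ∣projection∣≤ M ⟩
    ∣ M ∣              ≡⟨ ∣M∣≡b ⟩
    b                  ∎

  rootRow : Bool → Subset n
  rootRow b = if b then ⁅ r ⁆ else ⊥

  roots-over : Subset m → Subset (m * n)
  roots-over P = fromRows (rootRow ∘ lookup P)

  root∈roots-over : ∀ {P i} → i ∈ P → ⟨ i , r ⟩ ∈ roots-over P
  root∈roots-over {P} i∈P =
    ∈-fromRows (rootRow ∘ lookup P) (subst (λ b → r ∈ rootRow b) (sym (∈⇒lookup i∈P)) (x∈⁅x⁆ r))

  dem-roots : IsTree H → ∀ {P} → Nonempty P → IsDEM G P → IsDEM X (roots-over P)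
  dem-roots tree {P} (l , l∈P) isP x y e with edge-cases e
  ... | inj₁ (cx≡cy , h) =
    ⟨ l , r ⟩ , root∈roots-over l∈P ,
    monitors-cong (sym (⟨⟩-unique refl refl)) (sym (⟨⟩-unique (sym cx≡cy) refl))
                  (tree-copy-edge-monitored tree h (copyOf x) l)
  ... | inj₂ (px≡r , py≡r , g) =
    let (l′ , l′∈P , mon) = isP (copyOf x) (copyOf y) g in
    ⟨ l′ , r ⟩ , root∈roots-over l′∈P ,
    monitors-cong (sym (⟨⟩-unique refl px≡r)) (sym (⟨⟩-unique refl py≡r)) (root-monitors g mon)

  ∣roots-over∣ : ∀ P → ∣ roots-over P ∣ ≡ ∣ P ∣
  ∣roots-over∣ P =
    trans (∣fromRows∣ (rootRow ∘ lookup P)) (trans (∑-cong (∣rootRow∣ ∘ lookup P)) (sym (∣p∣≡∑ P)))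
    where
    ∣rootRow∣ : ∀ b → ∣ rootRow b ∣ ≡ indicator b
    ∣rootRow∣ true  = ∣⁅x⁆∣≡1 r
    ∣rootRow∣ false = ∣⊥∣≡0 n

  tree⇒dem⊙≤dem : 2 ≤ m → IsTree H → IsDem G a → IsDem X b → b ≤ a
  tree⇒dem⊙≤dem {a = a} {b = b} 2≤m tree ((P , isP , ∣P∣≡a) , _) (_ , minX) = begin
    b                  ≤⟨ minX _ (dem-roots tree (dem-nonempty G 2≤m connG isP) isP) ⟩
    ∣ roots-over P ∣   ≡⟨ ∣roots-over∣ P ⟩
    ∣ P ∣              ≡⟨ ∣P∣≡a ⟩
    a                  ∎

  -- By cycle⇒avoidable-edge and outside-¬monitors, every copy contains a monitor.
  cycle⇒order≤dem : Cycle H → ∀ {M} → IsDEM X M → m ≤ ∣ M ∣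
  cycle⇒order≤dem C {M} isM with cycle⇒avoidable-edge H connH C r
  ... | c , c′ , e , avᶜ , avᶜ′ = begin
    m                        ≡⟨ trans (∑-const m 1) (*-identityʳ m) ⟨
    ∑ {m} (λ _ → 1)          ≤⟨ ∑-mono-≤ row-hit ⟩
    ∑ (λ i → ∣ row M i ∣)    ≡⟨ ∣M∣≡∑rows M ⟨
    ∣ M ∣                    ∎
    where
    row-hit : ∀ i → 1 ≤ ∣ row M i ∣
    row-hit i with isM ⟨ i , c ⟩ ⟨ i , c′ ⟩ (copy-edge e)
    ... | x , x∈M , mon = ∈⇒1≤∣∣ (∈-row (subst (_∈ M) (⟨⟩-unique cx≡i refl) x∈M))
      where
      cx≡i : copyOf x ≡ i
      cx≡i = decidable-stable (copyOf x ≟ i) λ cx≢i → outside-¬monitors connG connH avᶜ avᶜ′ cx≢i mon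

  cycle⇒dem<dem⊙ : 1 ≤ m → Cycle H → IsDem G a → IsDem X b → a < b
  cycle⇒dem<dem⊙ {a = a} {b = b} 1≤m C demG ((M , isM , ∣M∣≡b) , _) = begin-strict
    a      <⟨ dem<order G 1≤m demG ⟩
    m      ≤⟨ cycle⇒order≤dem C isM ⟩
    ∣ M ∣  ≡⟨ ∣M∣≡b ⟩
    b      ∎

mainTheorem3 : ∀ {m n : ℕ} (G : Graph m) (H : Graph n) (r : Fin n) →
    2 ≤ m → 2 ≤ n → Connected G → Connected H →
    ∀ (a b c : ℕ) → IsDem G a → IsDem (G ⊙ H at r) b → IsDem H c →
    (a ≤ b × b ≤ m * c) × ((b ≡ a) ⇔ IsTree H)
mainTheorem3 G H r 2≤m 2≤n connG connH a b c demG demX demH =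
  (dem≤dem⊙ demG demX , dem⊙≤order*dem 2≤n demX demH) ,
  mk⇔ (λ b≡a → connH , λ C → <-irrefl (sym b≡a) (cycle⇒dem<dem⊙ (≤-trans (s≤s z≤n) 2≤m) C demG demX))
      (λ tree → ≤-antisym (tree⇒dem⊙≤dem 2≤m tree demG demX) (dem≤dem⊙ demG demX))
  where open Bounds G H r connG connH
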